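{- Let $k\ge 2$ be an integer and $p$ a prime. Then $J(k,p)=\emptyset$ if and only if there exists a positive integer $l$ such that $I(k,p,l)=\emptyset$.
   Context: For a real number $x$, $\lVert x\rVert$ denotes the distance from $x$ to the nearest integer. For positive integers $n\mid m$, $\pi_{m\to n}:\mathbb{Z}/m\mathbb{Z}\to\mathbb{Z}/n\mathbb{Z}$ is the natural projection (applied coordinatewise to tuples and elementwise to sets). For a prime $p$ and positive integer $l$, $\mathbb{Z}_{p,l}$ denotes the set of residues in $\mathbb{Z}/pl\mathbb{Z}$ that are not congruent to $0$ modulo $p$. Given an integer $k\ge 2$, a prime $p$ and a positive integer $l$, a tuple $\mathbf{v}=(v_1,\ldots,v_k)\in\mathbb{Z}_{p,l}^k$ is called $(k,p,l)$-proper if at least one of the following holds: (i) there is an index $i$ with $\gcd(l,v_1,\ldots,v_{i-1},v_{i+1},\ldots,v_k)>1$ (computed with any integer representatives); (ii) there is $t\in\frac{1}{lp}\mathbb{Z}$ with $\lVert t v_i\rVert\ge\frac{1}{k+1}$ for all $i$ (well defined since $v_i$ is a residue mod $lp$). Otherwise $\mathbf{v}$ is $(k,p,l)$-improper, and $I(k,p,l)\subseteq\mathbb{Z}_{p,l}^k$ is the set of $(k,p,l)$-improper tuples. A tuple $\mathbf{v}\in\mathbb{Z}_{p,1}^k$ is eventually $(k,p)$-proper if there is a positive integer $l$ with $\mathbf{v}\notin\pi_{lp\to p}(I(k,p,l))$; $J(k,p)$ is the set of $\mathbf{v}\in\mathbb{Z}_{p,1}^k$ that are not eventually $(k,p)$-proper.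 -}

module Defs where

open import Data.Nat using (ℕ; suc; _∸_; _⊓_; _*_; _≤_; _<_; NonZero)
open import Data.Nat.Properties using (m*n≢0)
open import Data.Nat.DivMod using (_mod_)
open import Data.Nat.Divisibility using (_∣_)
open import Data.Nat.GCD using (gcd)
open import Data.Integer as ℤ using (ℤ; _%ℕ_)
open import Data.Fin as Fin using (Fin; toℕ)
open import Data.List using (foldr; map; filter; allFin)
open import Data.Product using (Σ; _×_)
open import Data.Sum using (_⊎_)
open import Function using (_∘_)
open import Relation.Nullary using (¬_; ¬?)
open import Relation.Binary.PropositionalEquality using (_≡_)

-- Residues of ℤ/mℤ are represented by their canonical representatives Fin m.
-- ℤ_{p,l} membership: residue mod p*l not ≡ 0 mod p.
InZpl : (p l : ℕ) → Fin (p * l) → Set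
InZpl p l x = ¬ (p ∣ toℕ x)

InZp : (p : ℕ) → Fin p → Set
InZp p x = ¬ (p ∣ toℕ x)

-- For an integer x and N > 0:  ‖ x / N ‖ = distNum N x / N,
-- where distNum N x = min (x mod N) (N - x mod N).
distNum : (N : ℕ) .{{_ : NonZero N}} → ℤ → ℕ
distNum N x = (x %ℕ N) ⊓ (N ∸ (x %ℕ N))

gcdExcept : (l : ℕ) {k : ℕ} → (Fin k → ℕ) → Fin k → ℕ
gcdExcept l {k} v i = foldr gcd l (map v (filter (λ j → ¬? (j Fin.≟ i)) (allFin k)))

-- (k,p,l)-proper.  Condition (ii): t = a/(lp) with a ∈ ℤ, and
-- ‖ t v_i ‖ ≥ 1/(k+1)  ⇔  lp ≤ (k+1) * distNum (lp) (a * v_i).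
Proper : (k p l : ℕ) .{{_ : NonZero p}} .{{_ : NonZero l}} → (Fin k → Fin (p * l)) → Set
Proper k p l v =
  (Σ (Fin k) λ i → 1 < gcdExcept l (toℕ ∘ v) i)
  ⊎ (Σ ℤ λ a → ∀ i → p * l ≤ suc k * distNum (p * l) {{m*n≢0 p l}} (a ℤ.* ℤ.+ (toℕ (v i))))

InI : (k p l : ℕ) .{{_ : NonZero p}} .{{_ : NonZero l}} → (Fin k → Fin (p * l)) → Set
InI k p l v = (∀ i → InZpl p l (v i)) × ¬ Proper k p l v

IEmpty : (k p l : ℕ) .{{_ : NonZero p}} .{{_ : NonZero l}} → Set
IEmpty k p l = ∀ v → ¬ InI k p l v

proj : (p l : ℕ) .{{_ : NonZero p}} → Fin (p * l) → Fin p
proj p l x = toℕ x mod p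

InProjI : (k p l : ℕ) .{{_ : NonZero p}} .{{_ : NonZero l}} → (Fin k → Fin p) → Set
InProjI k p l v = Σ (Fin k → Fin (p * l)) λ w → InI k p l w × (∀ i → proj p l (w i) ≡ v i)

EventuallyProper : (k p : ℕ) .{{_ : NonZero p}} → (Fin k → Fin p) → Set
EventuallyProper k p ⦃ nzp ⦄ v = Σ ℕ λ l → Σ (NonZero l) λ nz → ¬ InProjI k p l ⦃ nzp ⦄ ⦃ nz ⦄ v

JEmpty : (k p : ℕ) .{{_ : NonZero p}} → Set
JEmpty k p = ∀ (v : Fin k → Fin p) → (∀ i → InZp p (v i)) → EventuallyProper k p v

{-# OPTIONS --safe #-}

-- If l ∣ L, reducing a tuple w ∈ I(k,p,L) modulo pl gives a tuple of I(k,p,l) with the same image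
-- mod p: a common divisor of l and the reduced coordinates also divides L and the original ones, and
-- a witness t = a/(pl) for the reduced tuple lifts to a witness for w at level L = ql. Hence
-- v ∉ π(I(k,p,l)) persists when l is replaced by a multiple, and if every v is eventually proper,
-- the product L of the finitely many witnesses l_v gives π(I(k,p,L)) = ∅, i.e. I(k,p,L) = ∅.

module Submission where

open import Defs
open import Data.Nat.Base as ℕ
  using (ℕ; zero; suc; _+_; _*_; _%_; _∸_; _⊓_; _≤_; _<_; NonZero; ≢-nonZero⁻¹)
open import Data.Nat.Properties
  using ( m*n≢0; *-assoc; *-commutativeSemigroup; *-distribʳ-∸; *-distribʳ-⊓; *-monoˡ-≤; <-≤-trans
        ; module ≤-Reasoning)
open import Algebra.Properties.CommutativeSemigroup *-commutativeSemigroup using (x∙yz≈xz∙y; xy∙z≈xz∙y)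
open import Data.Nat.DivMod
  using (_mod_; m≡m%n+[m/n]*n; m%n%n≡m%n; [m+kn]%n≡m%n; m<n⇒m%n≡m; %-congˡ; %-distribˡ-*;
         m%n*o≡m*o%[n*o]; m∣n⇒o%n%m≡o%m)
open import Data.Nat.Divisibility
  using (_∣_; _∣?_; ∣-refl; ∣-trans; n∣m*n; m∣m*n; ∣m∣n⇒∣m+n; 0∣⇒≡0; ∣⇒≤)
open import Data.Nat.GCD using (gcd; gcd[m,n]∣m; gcd[m,n]∣n; gcd-greatest)
open import Data.Nat.ListAction using (product)
open import Data.Nat.ListAction.Properties using (∈⇒∣product; product≢0)
open import Data.Nat.Primality using (Prime; prime⇒nonZero)
open import Data.Integer.Base as ℤ using (ℤ; +_; -[1+_]; _%ℕ_; _/ℕ_)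
open import Data.Integer.Properties using (+-injective; pos-*)
open import Data.Integer.DivMod using (a≡a%ℕn+[a/ℕn]*n; n%ℕd<d)
open import Data.Integer.Tactic.RingSolver using (solve-∀)
open import Data.Fin as Fin using (Fin; toℕ)
open import Data.Fin.Properties using (toℕ-fromℕ<; toℕ-injective; all?)
open import Data.List.Base using ([]; _∷_; foldr; map; filter; allFin; tabulate)
open import Data.List.Relation.Unary.All as All using (All; []; _∷_)
open import Data.List.Relation.Unary.All.Properties using (tabulate⁺)
open import Data.List.Membership.Propositional.Properties using (∈-tabulate⁺)
import Data.Vec.Functional as Vector
open import Data.Product.Base using (Σ; _×_; _,_; proj₁; proj₂)
open import Data.Sum.Base using (inj₁; inj₂)
open import Function.Base using (_∘_)
open import Function.Bundles using (_⇔_; mk⇔)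
open import Relation.Nullary using (¬_; ¬?; yes; no; contradiction)
open import Relation.Binary.PropositionalEquality
  using (_≡_; _≗_; refl; sym; trans; cong; subst; module ≡-Reasoning)

a≡a+bc+[-b]c : ∀ (a b c : ℤ) → a ≡ (a ℤ.+ b ℤ.* c) ℤ.+ (ℤ.- b) ℤ.* c
a≡a+bc+[-b]c = solve-∀

%-unique : ∀ n r N .{{_ : NonZero N}} (m : ℤ) → r < N → + n ≡ + r ℤ.+ m ℤ.* + N → n % N ≡ r
%-unique n r N (+ t) r<N eq = begin
  n % N           ≡⟨ %-congˡ (+-injective (trans eq (cong (ℤ._+_ (+ r)) (sym (pos-* t N))))) ⟩
  (r + t * N) % N ≡⟨ [m+kn]%n≡m%n r t N ⟩
  r % N           ≡⟨ m<n⇒m%n≡m r<N ⟩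
  r               ∎
  where open ≡-Reasoning
%-unique n r N -[1+ t ] r<N eq = sym (begin
  r                   ≡⟨ m<n⇒m%n≡m r<N ⟨
  r % N               ≡⟨ %-congˡ (+-injective r≡n+[1+t]N) ⟩
  (n + suc t * N) % N ≡⟨ [m+kn]%n≡m%n n (suc t) N ⟩
  n % N               ∎)
  where
  open ≡-Reasoning
  r≡n+[1+t]N : + r ≡ + (n + suc t * N)
  r≡n+[1+t]N = begin
    + r                                            ≡⟨ a≡a+bc+[-b]c (+ r) -[1+ t ] (+ N) ⟩
    (+ r ℤ.+ -[1+ t ] ℤ.* + N) ℤ.+ + suc t ℤ.* + N ≡⟨ cong (ℤ._+ + suc t ℤ.* + N) eq ⟨
    + n ℤ.+ + suc t ℤ.* + N                        ≡⟨ cong (ℤ._+_ (+ n)) (pos-* (suc t) N) ⟨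
    + (n + suc t * N)                              ∎

+n+m*N%ℕN≡n%N : ∀ n (m : ℤ) N .{{_ : NonZero N}} → (+ n ℤ.+ m ℤ.* + N) %ℕ N ≡ n % N
+n+m*N%ℕN≡n%N n m N = sym (%-unique n (c %ℕ N) N (c /ℕ N ℤ.- m) (n%ℕd<d c N) n≡r+[q-m]N)
  where
  open ≡-Reasoning
  c = + n ℤ.+ m ℤ.* + N
  regroup : ∀ r q m d → (r ℤ.+ q ℤ.* d) ℤ.+ (ℤ.- m) ℤ.* d ≡ r ℤ.+ (q ℤ.- m) ℤ.* d
  regroup = solve-∀
  n≡r+[q-m]N : + n ≡ + (c %ℕ N) ℤ.+ (c /ℕ N ℤ.- m) ℤ.* + N
  n≡r+[q-m]N = begin
    + n                                                 ≡⟨ a≡a+bc+[-b]c (+ n) m (+ N) ⟩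
    c ℤ.+ (ℤ.- m) ℤ.* + N                               ≡⟨ cong (ℤ._+ (ℤ.- m) ℤ.* + N) (a≡a%ℕn+[a/ℕn]*n c N) ⟩
    (+ (c %ℕ N) ℤ.+ c /ℕ N ℤ.* + N) ℤ.+ (ℤ.- m) ℤ.* + N ≡⟨ regroup (+ (c %ℕ N)) (c /ℕ N) m (+ N) ⟩
    + (c %ℕ N) ℤ.+ (c /ℕ N ℤ.- m) ℤ.* + N               ∎

*-%ℕ : ∀ (a : ℤ) x N .{{_ : NonZero N}} → (a ℤ.* + x) %ℕ N ≡ (a %ℕ N * x) % N
*-%ℕ a x N = begin
  (a ℤ.* + x) %ℕ N                         ≡⟨ cong (λ b → (b ℤ.* + x) %ℕ N) (a≡a%ℕn+[a/ℕn]*n a N) ⟩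
  ((+ r ℤ.+ q ℤ.* + N) ℤ.* + x) %ℕ N       ≡⟨ cong (_%ℕ N) (distrib (+ r) q (+ N) (+ x)) ⟩
  (+ r ℤ.* + x ℤ.+ q′ ℤ.* + N) %ℕ N        ≡⟨ cong (λ b → (b ℤ.+ q′ ℤ.* + N) %ℕ N) (pos-* r x) ⟨
  (+ (r * x) ℤ.+ q′ ℤ.* + N) %ℕ N          ≡⟨ +n+m*N%ℕN≡n%N (r * x) q′ N ⟩
  (r * x) % N                              ∎
  where
  open ≡-Reasoning
  r = a %ℕ N
  q = a /ℕ N
  q′ = q ℤ.* + x
  distrib : ∀ a b c d → (a ℤ.+ b ℤ.* c) ℤ.* d ≡ a ℤ.* d ℤ.+ (b ℤ.* d) ℤ.* c
  distrib = solve-∀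

m*[n%o]%o≡m*n%o : ∀ m n o .{{_ : NonZero o}} → (m * (n % o)) % o ≡ (m * n) % o
m*[n%o]%o≡m*n%o m n o = begin
  (m * (n % o)) % o           ≡⟨ %-distribˡ-* m (n % o) o ⟩
  (m % o * (n % o % o)) % o   ≡⟨ cong (λ r → (m % o * r) % o) (m%n%n≡m%n n o) ⟩
  (m % o * (n % o)) % o       ≡⟨ %-distribˡ-* m n o ⟨
  (m * n) % o                 ∎
  where open ≡-Reasoning

∣m%n∣n⇒∣m : ∀ {d} m n .{{_ : NonZero n}} → d ∣ m % n → d ∣ n → d ∣ m
∣m%n∣n⇒∣m m n d∣m%n d∣n =
  subst (_ ∣_) (sym (m≡m%n+[m/n]*n m n)) (∣m∣n⇒∣m+n d∣m%n (∣-trans d∣n (n∣m*n (m ℕ./ n))))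

∣⇒nonZero : ∀ {m n} .{{_ : NonZero n}} → m ∣ n → NonZero m
∣⇒nonZero {zero}  {n} 0∣n = contradiction (0∣⇒≡0 0∣n) (≢-nonZero⁻¹ n)
∣⇒nonZero {suc m} _       = _

distNum-cong : ∀ N .{{_ : NonZero N}} (z z′ : ℤ) → z %ℕ N ≡ z′ %ℕ N → distNum N z ≡ distNum N z′
distNum-cong N _ _ eq = cong (λ r → r ⊓ (N ∸ r)) eq

distNum-*ʳ : ∀ {M} N q .{{_ : NonZero M}} .{{_ : NonZero N}} → M ≡ N * q →
             ∀ n → distNum M (+ (n * q)) ≡ distNum N (+ n) * q
distNum-*ʳ N q refl n = begin
  (n * q) % (N * q) ⊓ (N * q ∸ (n * q) % (N * q))
    ≡⟨ cong (λ r → r ⊓ (N * q ∸ r)) (m%n*o≡m*o%[n*o] n N q) ⟨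
  n % N * q ⊓ (N * q ∸ n % N * q)                 ≡⟨ cong (n % N * q ⊓_) (*-distribʳ-∸ q N (n % N)) ⟨
  n % N * q ⊓ ((N ∸ n % N) * q)                   ≡⟨ *-distribʳ-⊓ q (n % N) (N ∸ n % N) ⟨
  (n % N ⊓ (N ∸ n % N)) * q                       ∎
  where open ≡-Reasoning

∣-foldr-gcd⁻ : ∀ {A : Set} {d a} (f : A → ℕ) xs →
               d ∣ foldr gcd a (map f xs) → d ∣ a × All (λ x → d ∣ f x) xs
∣-foldr-gcd⁻ f []       d∣a = d∣a , []
∣-foldr-gcd⁻ f (x ∷ xs) d∣g with ∣-foldr-gcd⁻ f xs (∣-trans d∣g (gcd[m,n]∣n (f x) _))
... | d∣a , d∣fxs = d∣a , ∣-trans d∣g (gcd[m,n]∣m (f x) _) ∷ d∣fxs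

∣-foldr-gcd⁺ : ∀ {A : Set} {d a} (f : A → ℕ) xs →
               d ∣ a → All (λ x → d ∣ f x) xs → d ∣ foldr gcd a (map f xs)
∣-foldr-gcd⁺ f []       d∣a []              = d∣a
∣-foldr-gcd⁺ f (x ∷ xs) d∣a (d∣fx ∷ d∣fxs) = gcd-greatest d∣fx (∣-foldr-gcd⁺ f xs d∣a d∣fxs)

1<gcdExcept-transfer : ∀ {k l L} .{{_ : NonZero L}} (u v : Fin k → ℕ) i → l ∣ L →
                       (∀ {d} j → d ∣ l → d ∣ u j → d ∣ v j) →
                       1 < gcdExcept l u i → 1 < gcdExcept L v i
1<gcdExcept-transfer {k} {l} {L} u v i l∣L transfer 1<d = <-≤-trans 1<d (∣⇒≤ {{G≢0}} d∣G)
  where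
  js = filter (λ j → ¬? (j Fin.≟ i)) (allFin k)
  d = gcdExcept l u i
  G = gcdExcept L v i
  d∣G : d ∣ G
  d∣G with ∣-foldr-gcd⁻ u js (∣-refl {d})
  ... | d∣l , d∣us = ∣-foldr-gcd⁺ v js (∣-trans d∣l l∣L) (All.map (λ {j} → transfer j d∣l) d∣us)
  G≢0 : NonZero G
  G≢0 = ∣⇒nonZero (proj₁ (∣-foldr-gcd⁻ v js (∣-refl {G})))

module Reduction {p l L : ℕ} .{{_ : NonZero p}} .{{_ : NonZero l}} .{{_ : NonZero L}} (l∣L : l ∣ L) where

  instance
    pl≢0 : NonZero (p * l)
    pl≢0 = m*n≢0 p l
    pL≢0 : NonZero (p * L)
    pL≢0 = m*n≢0 p L

  open _∣_ l∣L renaming (quotient to q; equality to L≡q*l)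

  pL≡pl*q : p * L ≡ p * l * q
  pL≡pl*q = trans (cong (p *_) L≡q*l) (x∙yz≈xz∙y p q l)

  reduce : Fin (p * L) → Fin (p * l)
  reduce x = toℕ x mod (p * l)

  toℕ-reduce : ∀ x → toℕ (reduce x) ≡ toℕ x % (p * l)
  toℕ-reduce x = toℕ-fromℕ< _

  proj-reduce : ∀ x → proj p l (reduce x) ≡ proj p L x
  proj-reduce x = toℕ-injective (begin
    toℕ (proj p l (reduce x)) ≡⟨ toℕ-fromℕ< _ ⟩
    toℕ (reduce x) % p        ≡⟨ cong (_% p) (toℕ-reduce x) ⟩
    toℕ x % (p * l) % p       ≡⟨ m∣n⇒o%n%m≡o%m p (p * l) (toℕ x) (m∣m*n l) ⟩
    toℕ x % p                 ≡⟨ toℕ-fromℕ< _ ⟨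
    toℕ (proj p L x)          ∎)
    where open ≡-Reasoning

  reduce-InZpl : ∀ x → InZpl p L x → InZpl p l (reduce x)
  reduce-InZpl x p∤x p∣ρx = p∤x (∣m%n∣n⇒∣m (toℕ x) (p * l) (subst (p ∣_) (toℕ-reduce x) p∣ρx) (m∣m*n l))

  lift-witness : ℤ → ℤ
  lift-witness a = + (a %ℕ (p * l) * q)

  -- t′ = lift-witness a/(pL) = a₀/(pl) with a₀ ≡ a mod pl, so ‖t′x‖ = ‖(a/(pl)) · reduce x‖;
  -- only the common denominator changes from pl to pL = q·pl.
  reduce-distNum : ∀ a x → distNum (p * L) (lift-witness a ℤ.* + toℕ x)
                         ≡ distNum (p * l) (a ℤ.* + toℕ (reduce x)) * q
  reduce-distNum a x = begin
    distNum (p * L) (+ (a₀ * q) ℤ.* + x′)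
      ≡⟨ cong (distNum (p * L)) reassoc ⟨
    distNum (p * L) (+ (a₀ * x′ * q))
      ≡⟨ distNum-*ʳ (p * l) q pL≡pl*q (a₀ * x′) ⟩
    distNum (p * l) (+ (a₀ * x′)) * q
      ≡⟨ cong (_* q) (distNum-cong (p * l) (+ (a₀ * x′)) (a ℤ.* + ρx) same-residue) ⟩
    distNum (p * l) (a ℤ.* + ρx) * q
      ∎
    where
    open ≡-Reasoning
    a₀ = a %ℕ (p * l)
    x′ = toℕ x
    ρx = toℕ (reduce x)
    reassoc : + (a₀ * x′ * q) ≡ + (a₀ * q) ℤ.* + x′
    reassoc = trans (cong +_ (xy∙z≈xz∙y a₀ x′ q)) (pos-* (a₀ * q) x′)
    same-residue : (a₀ * x′) % (p * l) ≡ (a ℤ.* + ρx) %ℕ (p * l)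
    same-residue = sym (begin
      (a ℤ.* + ρx) %ℕ (p * l)         ≡⟨ *-%ℕ a ρx (p * l) ⟩
      (a₀ * ρx) % (p * l)             ≡⟨ cong (λ r → (a₀ * r) % (p * l)) (toℕ-reduce x) ⟩
      (a₀ * (x′ % (p * l))) % (p * l) ≡⟨ m*[n%o]%o≡m*n%o a₀ x′ (p * l) ⟩
      (a₀ * x′) % (p * l)             ∎)

  reduce-Proper : ∀ {k} (w : Fin k → Fin (p * L)) → Proper k p l (reduce ∘ w) → Proper k p L w
  reduce-Proper w (inj₁ (i , 1<gcd)) =
    inj₁ (i , 1<gcdExcept-transfer (toℕ ∘ reduce ∘ w) (toℕ ∘ w) i l∣L lift-divisor 1<gcd)
    where
    lift-divisor : ∀ {d} j → d ∣ l → d ∣ toℕ (reduce (w j)) → d ∣ toℕ (w j)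
    lift-divisor j d∣l d∣ρw =
      ∣m%n∣n⇒∣m (toℕ (w j)) (p * l) (subst (_ ∣_) (toℕ-reduce (w j)) d∣ρw) (∣-trans d∣l (n∣m*n p))
  reduce-Proper {k} w (inj₂ (a , far)) = inj₂ (lift-witness a , λ i → begin
    p * L                     ≡⟨ pL≡pl*q ⟩
    p * l * q                 ≤⟨ *-monoˡ-≤ q (far i) ⟩
    suc k * D i * q           ≡⟨ *-assoc (suc k) (D i) q ⟩
    suc k * (D i * q)         ≡⟨ cong (suc k *_) (reduce-distNum a (w i)) ⟨
    suc k * distNum (p * L) (lift-witness a ℤ.* + toℕ (w i)) ∎)
    where
    open ≤-Reasoning
    D : Fin k → ℕ
    D i = distNum (p * l) (a ℤ.* + toℕ (reduce (w i)))

  reduce-InI : ∀ {k} (w : Fin k → Fin (p * L)) → InI k p L w → InI k p l (reduce ∘ w)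
  reduce-InI w (w∈ℤₚₗ , improper) = (λ i → reduce-InZpl (w i) (w∈ℤₚₗ i)) , improper ∘ reduce-Proper w

InProjI-∣ : ∀ {k p l L} .{{_ : NonZero p}} .{{_ : NonZero l}} .{{_ : NonZero L}} {v : Fin k → Fin p} →
            l ∣ L → InProjI k p L v → InProjI k p l v
InProjI-∣ {p = p} l∣L (w , w∈I , πw≡v) =
  reduce ∘ w , reduce-InI w w∈I , λ i → trans (proj-reduce (w i)) (πw≡v i)
  where open Reduction {p = p} l∣L

InProjI⇒InZp : ∀ {k p l} .{{_ : NonZero p}} .{{_ : NonZero l}} {v : Fin k → Fin p} →
               InProjI k p l v → ∀ i → InZp p (v i)
InProjI⇒InZp {p = p} (w , (w∈ℤₚₗ , _) , πw≡v) i p∣vi = w∈ℤₚₗ i (∣m%n∣n⇒∣m (toℕ (w i)) p p∣wi%p ∣-refl)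
  where
  p∣wi%p : p ∣ toℕ (w i) % p
  p∣wi%p = subst (p ∣_) (trans (cong toℕ (sym (πw≡v i))) (toℕ-fromℕ< _)) p∣vi

MultiplesClosed : (ℕ → Set) → Set
MultiplesClosed P = ∀ {l L} .{{_ : NonZero L}} → l ∣ L → P l → P L

SomeNonZero : (ℕ → Set) → Set
SomeNonZero P = Σ ℕ λ l → NonZero l × P l

common-witness-Fin : ∀ {n} (P : Fin n → ℕ → Set) → (∀ i → MultiplesClosed (P i)) →
                     (∀ i → SomeNonZero (P i)) → SomeNonZero (λ L → ∀ i → P i L)
common-witness-Fin P closed witness = product ls , ls≢0 , λ i →
    closed i {{ls≢0}} (∈⇒∣product (∈-tabulate⁺ i)) (proj₂ (proj₂ (witness i)))
  where
  ls = tabulate (proj₁ ∘ witness)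
  ls≢0 = product≢0 (tabulate⁺ (proj₁ ∘ proj₂ ∘ witness))

common-witness-tuples : ∀ k {n} (P : (Fin k → Fin n) → ℕ → Set) →
                        (∀ {u v} → u ≗ v → ∀ {l} → P u l → P v l) → (∀ v → MultiplesClosed (P v)) →
                        (∀ v → SomeNonZero (P v)) → SomeNonZero (λ L → ∀ v → P v L)
common-witness-tuples zero P resp closed witness with witness (λ ())
... | l , l≢0 , Pl = l , l≢0 , λ v → resp (λ ()) Pl
common-witness-tuples (suc k) P resp closed witness
  with common-witness-Fin (λ x L → ∀ g → P (x Vector.∷ g) L)
         (λ x l∣L Pl g → closed (x Vector.∷ g) l∣L (Pl g))
         (λ x → common-witness-tuples k (λ g → P (x Vector.∷ g))
                  (λ u≗v → resp λ { Fin.zero → refl ; (Fin.suc i) → u≗v i })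
                  (λ g → closed (x Vector.∷ g)) (λ g → witness (x Vector.∷ g)))
... | L , L≢0 , PL = L , L≢0 , λ v →
  resp (λ { Fin.zero → refl ; (Fin.suc i) → refl }) (PL (v Fin.zero) (v ∘ Fin.suc))

NotInProjI : (k p : ℕ) .{{_ : NonZero p}} → (Fin k → Fin p) → ℕ → Set
NotInProjI k p ⦃ p≢0 ⦄ v l = (l≢0 : NonZero l) → ¬ InProjI k p l ⦃ p≢0 ⦄ ⦃ l≢0 ⦄ v

NotInProjI-resp-≗ : ∀ {k p} .{{_ : NonZero p}} {u v : Fin k → Fin p} → u ≗ v → ∀ {l} →
                    NotInProjI k p u l → NotInProjI k p v l
NotInProjI-resp-≗ u≗v u∉ l≢0 (w , w∈I , πw≡v) = u∉ l≢0 (w , w∈I , λ i → trans (πw≡v i) (sym (u≗v i)))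

NotInProjI-multiplesClosed : ∀ {k p} .{{_ : NonZero p}} (v : Fin k → Fin p) → MultiplesClosed (NotInProjI k p v)
NotInProjI-multiplesClosed v l∣L v∉ _ v∈ = v∉ l≢0 (InProjI-∣ l∣L v∈)
  where
  instance
    l≢0 : NonZero _
    l≢0 = ∣⇒nonZero l∣L

JEmpty⇒NotInProjI : ∀ {k p} .{{_ : NonZero p}} → JEmpty k p → ∀ v → SomeNonZero (NotInProjI k p v)
JEmpty⇒NotInProjI {p = p} J v with all? (λ i → ¬? (p ∣? toℕ (v i)))
... | yes v∈ℤₚ = let (l , l≢0 , v∉) = J v v∈ℤₚ in l , l≢0 , λ _ → v∉
... | no  v∉ℤₚ = 1 , _ , λ _ v∈ → v∉ℤₚ (InProjI⇒InZp v∈)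

lemma8 : (k p : ℕ) → 2 ≤ k → (pp : Prime p) →
    JEmpty k p {{prime⇒nonZero pp}}
      ⇔ (Σ ℕ λ l → Σ (NonZero l) λ nz → IEmpty k p l {{prime⇒nonZero pp}} {{nz}})
lemma8 k p _ pp = mk⇔ forward backward
  where
  instance
    p≢0 : NonZero p
    p≢0 = prime⇒nonZero pp

  forward : JEmpty k p → Σ ℕ λ L → Σ (NonZero L) λ L≢0 → IEmpty k p L ⦃ p≢0 ⦄ ⦃ L≢0 ⦄
  forward J with common-witness-tuples k (NotInProjI k p) NotInProjI-resp-≗ NotInProjI-multiplesClosed
                   (JEmpty⇒NotInProjI J)
  ... | L , L≢0 , avoids = L , L≢0 , λ w w∈I → avoids (proj p L ∘ w) L≢0 (w , w∈I , λ _ → refl)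

  backward : (Σ ℕ λ l → Σ (NonZero l) λ l≢0 → IEmpty k p l ⦃ p≢0 ⦄ ⦃ l≢0 ⦄) → JEmpty k p
  backward (l , l≢0 , I≡∅) _ _ = l , l≢0 , λ (w , w∈I , _) → I≡∅ w w∈I
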